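{- Let $n\ge1$, let $K:\mathfrak S_n(123)\to\mathcal D_n$ be Krattenthaler's map, and let $\pi\in\mathfrak S_n(123)$ and $P\in\mathcal D_n$. Then $K(\pi)=P$ if and only if for all $i,a\in\{1,\dots,n\}$: $$(a,n+1-i)\in\mathrm{RMAX}(\pi)\iff(a,i)\in\mathrm{PEAK}(P).$$
   Context: Permutations are words $a_1\dots a_n$ with $a_i=\pi(i)$; $\mathfrak S_n(123)$ is the set of permutations with no $i<j<k$ such that $a_i<a_j<a_k$. A letter $a_i$ is a right-to-left maximum if $a_i>a_j$ for all $j>i$; $\mathrm{RMAX}(\pi)=\{(i,a_i): a_i\text{ a right-to-left maximum}\}$. $\mathcal D_n$ is the set of Dyck paths of semilength $n$ as words in $u,d$. For $P\in\mathcal D_n$, index up-steps $u_1,\dots,u_n$ and down-steps $d_1,\dots,d_n$ from left to right, and let $\mathrm{PEAK}(P)=\{(i,j): u_i\text{ is immediately followed by }d_j\}$. Krattenthaler's map $K$: write the right-to-left maxima of $\pi\in\mathfrak S_n(123)$, read from right to left, as $m_1,m_2,\dots,m_s$, so $\pi=w_sm_s\dots w_2m_2w_1m_1$ with (possibly empty) words $w_j$. Reading $\pi$ from right to left, translate each $m_j$ into $m_j-m_{j-1}$ up-steps (with $m_0=0$) and each $w_j$ into $|w_j|+1$ down-steps, concatenating in this order; then $K(\pi)$ is the reflection of the resulting path in a vertical line (i.e. reverse the word and interchange $u$ and $d$). For example, $K(536142)=uuudduudduddd$. -}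

module Defs where

open import Data.Nat using (ℕ; zero; suc; _+_; _∸_; _<_; _≤_; _<ᵇ_)
open import Data.Bool using (if_then_else_)
open import Data.Fin using (Fin; toℕ)
open import Data.List using (List; []; _∷_; length; lookup; reverse; map; replicate; _++_; upTo; take; filterᵇ)
open import Data.List.Relation.Binary.Permutation.Propositional using (_↭_)
open import Data.Product using (_×_; ∃; _,_)
open import Relation.Binary.PropositionalEquality using (_≡_)
open import Relation.Nullary using (¬_)

IsPerm : ℕ → List ℕ → Set
IsPerm n w = w ↭ map suc (upTo n)

Avoids123 : List ℕ → Set
Avoids123 w = (i j k : Fin (length w)) → toℕ i < toℕ j → toℕ j < toℕ k →
  ¬ (lookup w i < lookup w j × lookup w j < lookup w k)

IsPerm123 : ℕ → List ℕ → Set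
IsPerm123 n w = IsPerm n w × Avoids123 w

InRMAX : List ℕ → ℕ → ℕ → Set
InRMAX w i a = ∃ λ (p : Fin (length w)) →
  (suc (toℕ p) ≡ i) × (lookup w p ≡ a) ×
  ((q : Fin (length w)) → toℕ p < toℕ q → lookup w q < a)

data Step : Set where
  u d : Step

isU : Step → Data.Bool.Bool
isU u = Data.Bool.true
isU d = Data.Bool.false

isD : Step → Data.Bool.Bool
isD u = Data.Bool.false
isD d = Data.Bool.true

#u #d : List Step → ℕ
#u s = length (filterᵇ isU s)
#d s = length (filterᵇ isD s)

IsDyck : ℕ → List Step → Set
IsDyck n P = (#u P ≡ n) × (#d P ≡ n) × ((k : ℕ) → #d (take k P) ≤ #u (take k P))

InPEAK : List Step → ℕ → ℕ → Set
InPEAK P i j = ∃ λ (p : Fin (length P)) → ∃ λ (q : Fin (length P)) →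
  (suc (toℕ p) ≡ toℕ q) × (lookup P p ≡ u) × (lookup P q ≡ d) ×
  (#u (take (suc (toℕ p)) P) ≡ i) × (#d (take (suc (toℕ q)) P) ≡ j)

-- Reading π from right to left with current
-- right-to-left maximum m (initially 0): a new right-to-left maximum x
-- produces x ∸ m up-steps followed by one down-step (the "+1" of the
-- following word w_j), every other letter produces one down-step.
-- This is exactly  m_j ↦ u^{m_j - m_{j-1}},  w_j ↦ d^{|w_j|+1}.
krattGo : ℕ → List ℕ → List Step
krattGo m [] = []
krattGo m (x ∷ r) =
  if m <ᵇ x then replicate (x ∸ m) u ++ (d ∷ krattGo x r)
            else d ∷ krattGo m r

flipStep : Step → Step
flipStep u = d
flipStep d = u

reflect : List Step → List Step
reflect P = reverse (map flipStep P)

K : List ℕ → List Step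
K π = reflect (krattGo 0 (reverse π))

-- Read from left to right, K(π) is the word ∏ₖ u d^(aₖ ∸ mₖ), where mₖ is the maximum of
-- aₖ₊₁ … aₙ: every letter contributes an up-step, and only a right-to-left maximum aₖ is
-- followed by down-steps.  These aₖ ∸ mₖ down-steps together with the mₖ down-steps
-- of the later letters are exactly aₖ, so the peaks of K(π) are the pairs (k , n + 1 − aₖ)
-- with aₖ a right-to-left maximum.  Conversely, a word in u and d is determined by its
-- numbers of u's and d's together with its peaks, since between two consecutive peaks it
-- has the shape d*u*.
module Submission where

open import Defs
open import Data.Nat using (ℕ; zero; suc; _+_; _∸_; _≤_; _<_; _⊔_; _<ᵇ_; z≤n; s≤s; s≤s⁻¹; z<s)
open import Data.Nat.Properties
open import Data.Bool using (true; false)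
open import Data.Fin using (Fin; toℕ; zero; suc)
open import Data.List using (List; []; _∷_; _++_; _∷ʳ_; length; lookup; reverse; map; replicate; take; foldr; foldl; upTo)
open import Data.List.Properties using (++-assoc; unfold-reverse; reverse-++; map-++; map-replicate; reverse-foldl; foldr-cong; tabulate-lookup; length-map; length-upTo)
open import Data.List.Relation.Unary.All as All using (All; []; _∷_)
open import Data.List.Relation.Unary.All.Properties using (tabulate⁺; tabulate⁻)
open import Data.List.Membership.Propositional using (_∈_)
open import Data.List.Membership.Propositional.Properties using (∈-map⁻; ∈-map⁺; ∈-upTo⁻; ∈-upTo⁺)
open import Data.List.Relation.Binary.Permutation.Propositional using (↭-sym)
open import Data.List.Relation.Binary.Permutation.Propositional.Properties using (All-resp-↭; ∈-resp-↭; ↭-length)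
open import Data.Product using (_×_; _,_; ∃; ∃₂; proj₁; proj₂)
open import Data.Sum using (_⊎_; inj₁; inj₂)
open import Data.Empty using (⊥-elim)
open import Function using (_∘_)
open import Function.Bundles using (_⇔_; mk⇔; Equivalence)
import Function.Properties.Equivalence as ⇔
open import Relation.Binary.Core using (_⇒_)
open import Relation.Binary.PropositionalEquality
open import Relation.Nullary using (¬_)
open import Relation.Nullary.Reflects using (ofʸ; ofⁿ)

private variable
  A : Set
  i j k a b n p x y m : ℕ
  ρ : List ℕ
  P Q : List Step

maximum : List ℕ → ℕ
maximum = foldr _⊔_ 0

m∸n+n≡m⊔n : ∀ m n → m ∸ n + n ≡ m ⊔ n
m∸n+n≡m⊔n m n with ≤-total n m
... | inj₁ n≤m = trans (m∸n+n≡m n≤m) (sym (m≥n⇒m⊔n≡m n≤m))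
... | inj₂ m≤n = trans (cong (_+ n) (m≤n⇒m∸n≡0 m≤n)) (sym (m≤n⇒m⊔n≡n m≤n))

m∸n>0⇒n<m : 0 < m ∸ n → n < m
m∸n>0⇒n<m 0<m∸n = ≰⇒> (λ m≤n → <-irrefl (sym (m≤n⇒m∸n≡0 m≤n)) 0<m∸n)

m∸n+o+n≡o+[m⊔n] : ∀ m n o → m ∸ n + o + n ≡ o + (m ⊔ n)
m∸n+o+n≡o+[m⊔n] m n o = begin
  m ∸ n + o + n   ≡⟨ cong (_+ n) (+-comm (m ∸ n) o) ⟩
  o + (m ∸ n) + n ≡⟨ +-assoc o (m ∸ n) n ⟩
  o + (m ∸ n + n) ≡⟨ cong (o +_) (m∸n+n≡m⊔n m n) ⟩
  o + (m ⊔ n)     ∎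
  where open ≡-Reasoning

xs≤maximum : ∀ ρ → All (_≤ maximum ρ) ρ
xs≤maximum []      = []
xs≤maximum (x ∷ ρ) =
  m≤m⊔n x (maximum ρ) ∷ All.map (λ y≤ → ≤-trans y≤ (m≤n⊔m x (maximum ρ))) (xs≤maximum ρ)

maximum≤ : All (_≤ n) ρ → maximum ρ ≤ n
maximum≤ []         = z≤n
maximum≤ (x≤n ∷ h) = ⊔-lub x≤n (maximum≤ h)

maximum<⇒All< : maximum ρ < x → All (_< x) ρ
maximum<⇒All< {ρ} m<x = All.map (λ y≤ → ≤-<-trans y≤ m<x) (xs≤maximum ρ)

All<⇒maximum< : 0 < x → All (_< x) ρ → maximum ρ < x
All<⇒maximum< {suc x} _ h = s≤s (maximum≤ (All.map s≤s⁻¹ h))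

krattGo-∷ : ∀ m x r → krattGo m (x ∷ r) ≡ replicate (x ∸ m) u ++ d ∷ krattGo (m ⊔ x) r
krattGo-∷ m x r with m <ᵇ x | <ᵇ-reflects-< m x
... | true  | ofʸ m<x rewrite m≤n⇒m⊔n≡n (<⇒≤ m<x) = refl
... | false | ofⁿ m≮x rewrite m≤n⇒m∸n≡0 (≮⇒≥ m≮x) | m≥n⇒m⊔n≡m (≮⇒≥ m≮x) = refl

krattGo-∷ʳ : ∀ m l x →
  krattGo m (l ∷ʳ x) ≡ krattGo m l ++ replicate (x ∸ foldl _⊔_ m l) u ++ d ∷ []
krattGo-∷ʳ m []      x = krattGo-∷ m x []
krattGo-∷ʳ m (y ∷ l) x = begin
  krattGo m (y ∷ l ∷ʳ x)
    ≡⟨ krattGo-∷ m y (l ∷ʳ x) ⟩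
  replicate (y ∸ m) u ++ d ∷ krattGo (m ⊔ y) (l ∷ʳ x)
    ≡⟨ cong (λ t → replicate (y ∸ m) u ++ d ∷ t) (krattGo-∷ʳ (m ⊔ y) l x) ⟩
  replicate (y ∸ m) u ++ d ∷ krattGo (m ⊔ y) l ++ B
    ≡⟨ ++-assoc (replicate (y ∸ m) u) (d ∷ krattGo (m ⊔ y) l) B ⟨
  (replicate (y ∸ m) u ++ d ∷ krattGo (m ⊔ y) l) ++ B
    ≡⟨ cong (_++ B) (krattGo-∷ m y l) ⟨
  krattGo m (y ∷ l) ++ B
    ∎
  where
  open ≡-Reasoning
  B : List Step
  B = replicate (x ∸ foldl _⊔_ (m ⊔ y) l) u ++ d ∷ []

reverse-replicate : ∀ k (s : A) → reverse (replicate k s) ≡ replicate k s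
reverse-replicate zero    s = refl
reverse-replicate (suc k) s = begin
  reverse (s ∷ replicate k s) ≡⟨ unfold-reverse s (replicate k s) ⟩
  reverse (replicate k s) ∷ʳ s ≡⟨ cong (_∷ʳ s) (reverse-replicate k s) ⟩
  replicate k s ∷ʳ s          ≡⟨ replicate-∷ʳ k ⟩
  s ∷ replicate k s           ∎
  where
  open ≡-Reasoning
  replicate-∷ʳ : ∀ k → replicate k s ∷ʳ s ≡ s ∷ replicate k s
  replicate-∷ʳ zero    = refl
  replicate-∷ʳ (suc k) = cong (s ∷_) (replicate-∷ʳ k)

reflect-++ : ∀ P Q → reflect (P ++ Q) ≡ reflect Q ++ reflect P
reflect-++ P Q = trans (cong reverse (map-++ flipStep P Q)) (reverse-++ (map flipStep P) (map flipStep Q))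

reflect-uᵏd : ∀ k → reflect (replicate k u ++ d ∷ []) ≡ u ∷ replicate k d
reflect-uᵏd k = begin
  reflect (replicate k u ++ d ∷ [])              ≡⟨ reflect-++ (replicate k u) (d ∷ []) ⟩
  u ∷ reverse (map flipStep (replicate k u))     ≡⟨ cong (λ t → u ∷ reverse t) (map-replicate flipStep k u) ⟩
  u ∷ reverse (replicate k d)                    ≡⟨ cong (u ∷_) (reverse-replicate k d) ⟩
  u ∷ replicate k d                              ∎
  where open ≡-Reasoning

foldl-⊔-reverse : ∀ ρ → foldl _⊔_ 0 (reverse ρ) ≡ maximum ρ
foldl-⊔-reverse ρ = trans (reverse-foldl _⊔_ 0 ρ) (foldr-cong (λ x m → ⊔-comm m x) refl ρ)

K′ : List ℕ → List Step
K′ []      = []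
K′ (x ∷ ρ) = u ∷ replicate (x ∸ maximum ρ) d ++ K′ ρ

K≡K′ : ∀ π → K π ≡ K′ π
K≡K′ []      = refl
K≡K′ (x ∷ ρ) = begin
  reflect (krattGo 0 (reverse (x ∷ ρ)))
    ≡⟨ cong (reflect ∘ krattGo 0) (unfold-reverse x ρ) ⟩
  reflect (krattGo 0 (reverse ρ ∷ʳ x))
    ≡⟨ cong reflect (krattGo-∷ʳ 0 (reverse ρ) x) ⟩
  reflect (krattGo 0 (reverse ρ) ++ replicate (x ∸ m′) u ++ d ∷ [])
    ≡⟨ reflect-++ (krattGo 0 (reverse ρ)) _ ⟩
  reflect (replicate (x ∸ m′) u ++ d ∷ []) ++ K ρ
    ≡⟨ cong₂ _++_ (reflect-uᵏd (x ∸ m′)) (K≡K′ ρ) ⟩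
  u ∷ replicate (x ∸ m′) d ++ K′ ρ
    ≡⟨ cong (λ m → u ∷ replicate (x ∸ m) d ++ K′ ρ) (foldl-⊔-reverse ρ) ⟩
  K′ (x ∷ ρ)
    ∎
  where
  open ≡-Reasoning
  m′ : ℕ
  m′ = foldl _⊔_ 0 (reverse ρ)

#u-dᵏ : ∀ k P → #u (replicate k d ++ P) ≡ #u P
#u-dᵏ zero    P = refl
#u-dᵏ (suc k) P = #u-dᵏ k P

#d-dᵏ : ∀ k P → #d (replicate k d ++ P) ≡ k + #d P
#d-dᵏ zero    P = refl
#d-dᵏ (suc k) P = cong suc (#d-dᵏ k P)

#u-K′ : ∀ ρ → #u (K′ ρ) ≡ length ρ
#u-K′ []      = refl
#u-K′ (x ∷ ρ) = cong suc (trans (#u-dᵏ (x ∸ maximum ρ) (K′ ρ)) (#u-K′ ρ))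

#d-K′ : ∀ ρ → #d (K′ ρ) ≡ maximum ρ
#d-K′ []      = refl
#d-K′ (x ∷ ρ) = begin
  #d (replicate (x ∸ maximum ρ) d ++ K′ ρ) ≡⟨ #d-dᵏ (x ∸ maximum ρ) (K′ ρ) ⟩
  x ∸ maximum ρ + #d (K′ ρ)               ≡⟨ cong (x ∸ maximum ρ +_) (#d-K′ ρ) ⟩
  x ∸ maximum ρ + maximum ρ               ≡⟨ m∸n+n≡m⊔n x (maximum ρ) ⟩
  x ⊔ maximum ρ                           ∎
  where open ≡-Reasoning

-- Peak i j P a b: the word P, read after i up-steps and j down-steps, has its a-th up-step
-- immediately followed by its b-th down-step.
data Peak : ℕ → ℕ → List Step → ℕ → ℕ → Set where
  here    : Peak i j (u ∷ d ∷ P) (suc i) (suc j)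
  after-u : Peak (suc i) j P a b → Peak i j (u ∷ P) a b
  after-d : Peak i (suc j) P a b → Peak i j (d ∷ P) a b

peak-up-bounds : Peak i j P a b → i < a × a ≤ i + #u P
peak-up-bounds {i = i} here = ≤-refl , m<m+n i z<s
peak-up-bounds {i = i} (after-u {P = P} p) with peak-up-bounds p
... | i<a , a≤ = <-trans (n<1+n i) i<a , ≤-trans a≤ (≤-reflexive (sym (+-suc i (#u P))))
peak-up-bounds (after-d p) = peak-up-bounds p

peak-down-bounds : Peak i j P a b → j < b × b ≤ j + #d P
peak-down-bounds {j = j} here = ≤-refl , m<m+n j z<s
peak-down-bounds (after-u p) = peak-down-bounds p
peak-down-bounds {j = j} (after-d {P = P} p) with peak-down-bounds p
... | j<b , b≤ = <-trans (n<1+n j) j<b , ≤-trans b≤ (≤-reflexive (sym (+-suc j (#d P))))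

InPEAKFrom : ℕ → ℕ → List Step → ℕ → ℕ → Set
InPEAKFrom i j P a b = ∃₂ λ (p q : Fin (length P)) →
  (suc (toℕ p) ≡ toℕ q) × (lookup P p ≡ u) × (lookup P q ≡ d) ×
  (i + #u (take (suc (toℕ p)) P) ≡ a) × (j + #d (take (suc (toℕ q)) P) ≡ b)

InPEAKFrom⇒Peak : ∀ i j P → InPEAKFrom i j P a b → Peak i j P a b
InPEAKFrom⇒Peak i j (_ ∷ P)     (zero , zero , () , _)
InPEAKFrom⇒Peak i j (_ ∷ _ ∷ P) (zero , suc (suc q) , () , _)
InPEAKFrom⇒Peak i j (_ ∷ P)     (suc p , zero , () , _)
InPEAKFrom⇒Peak i j (_ ∷ _ ∷ P) (zero , suc zero , refl , refl , refl , refl , refl) =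
  subst₂ (Peak i j (u ∷ d ∷ P)) (+-comm 1 i) (+-comm 1 j) here
InPEAKFrom⇒Peak i j (u ∷ P) (suc p , suc q , e , eu , ed , ea , eb) =
  after-u (InPEAKFrom⇒Peak (suc i) j P (p , q , suc-injective e , eu , ed , trans (sym (+-suc i _)) ea , eb))
InPEAKFrom⇒Peak i j (d ∷ P) (suc p , suc q , e , eu , ed , ea , eb) =
  after-d (InPEAKFrom⇒Peak i (suc j) P (p , q , suc-injective e , eu , ed , ea , trans (sym (+-suc j _)) eb))

Peak⇒InPEAKFrom : Peak i j P a b → InPEAKFrom i j P a b
Peak⇒InPEAKFrom {i} {j} here = zero , suc zero , refl , refl , refl , +-comm i 1 , +-comm j 1
Peak⇒InPEAKFrom {i} (after-u p) with Peak⇒InPEAKFrom p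
... | p′ , q , e , eu , ed , ea , eb = suc p′ , suc q , cong suc e , eu , ed , trans (+-suc i _) ea , eb
Peak⇒InPEAKFrom {j = j} (after-d p) with Peak⇒InPEAKFrom p
... | p′ , q , e , eu , ed , ea , eb = suc p′ , suc q , cong suc e , eu , ed , ea , trans (+-suc j _) eb

InPEAK⇔Peak : InPEAK P a b ⇔ Peak 0 0 P a b
InPEAK⇔Peak {P} = mk⇔ (InPEAKFrom⇒Peak 0 0 P) Peak⇒InPEAKFrom

first-peak : 0 < #d P → ∃ λ a → Peak i j (u ∷ P) a (suc j)
first-peak {d ∷ P} _ = _ , here
first-peak {u ∷ P} 0<#d with first-peak 0<#d
... | a , p = a , after-u p

Peak-tail-u : Peak i j (u ∷ P) ⇒ Peak i j (u ∷ Q) → Peak (suc i) j P ⇒ Peak (suc i) j Q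
Peak-tail-u f p with f (after-u p)
... | after-u q = q
... | here      = ⊥-elim (<-irrefl refl (proj₁ (peak-up-bounds p)))

Peak-tail-d : Peak i j (d ∷ P) ⇒ Peak i j (d ∷ Q) → Peak i (suc j) P ⇒ Peak i (suc j) Q
Peak-tail-d f p with f (after-d p)
... | after-d q = q

peaks-u∷⊈d∷ : #d P ≡ suc (#d Q) → ¬ (Peak i j (u ∷ P) ⇒ Peak i j (d ∷ Q))
peaks-u∷⊈d∷ e f with first-peak (subst (0 <_) (sym e) z<s)
... | _ , p with f p
...   | after-d q = <-irrefl refl (proj₁ (peak-down-bounds q))

peaks-determine : ∀ P Q → #u P ≡ #u Q → #d P ≡ #d Q →
  Peak i j P ⇒ Peak i j Q → Peak i j Q ⇒ Peak i j P → P ≡ Q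
peaks-determine []      []      _  _  _ _ = refl
peaks-determine []      (u ∷ Q) () _  _ _
peaks-determine []      (d ∷ Q) _  () _ _
peaks-determine (u ∷ P) []      () _  _ _
peaks-determine (d ∷ P) []      _  () _ _
peaks-determine (u ∷ P) (u ∷ Q) eu ed f g =
  cong (u ∷_) (peaks-determine P Q (suc-injective eu) ed (Peak-tail-u f) (Peak-tail-u g))
peaks-determine (d ∷ P) (d ∷ Q) eu ed f g =
  cong (d ∷_) (peaks-determine P Q eu (suc-injective ed) (Peak-tail-d f) (Peak-tail-d g))
peaks-determine (u ∷ P) (d ∷ Q) _  ed f _ = ⊥-elim (peaks-u∷⊈d∷ ed f)
peaks-determine (d ∷ P) (u ∷ Q) _  ed _ g = ⊥-elim (peaks-u∷⊈d∷ (sym ed) g)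

Peak-dᵏ⁺ : ∀ k → Peak i (k + j) P ⇒ Peak i j (replicate k d ++ P)
Peak-dᵏ⁺ zero    p = p
Peak-dᵏ⁺ {i} {j} {P} (suc k) {a} {b} p = after-d (Peak-dᵏ⁺ k (subst (λ t → Peak i t P a b) (sym (+-suc k j)) p))

Peak-dᵏ⁻ : ∀ k → Peak i j (replicate k d ++ P) ⇒ Peak i (k + j) P
Peak-dᵏ⁻ zero    p = p
Peak-dᵏ⁻ {i} {j} {P} (suc k) {a} {b} (after-d p) = subst (λ t → Peak i t P a b) (+-suc k j) (Peak-dᵏ⁻ k p)

Peak-block⁻ : ∀ k ρ → Peak i j (u ∷ replicate k d ++ K′ ρ) a b →
  (0 < k × a ≡ suc i × b ≡ suc j) ⊎ Peak (suc i) (k + j) (K′ ρ) a b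
Peak-block⁻ zero    []      (after-u p)           = inj₂ p
Peak-block⁻ zero    (_ ∷ _) (after-u p)           = inj₂ p
Peak-block⁻ (suc k) ρ       here                  = inj₁ (z<s , refl , refl)
Peak-block⁻ (suc k) ρ       (after-u (after-d p)) = inj₂ (Peak-dᵏ⁻ (suc k) (after-d p))

Peak-block⁺ : ∀ k ρ → (0 < k × a ≡ suc i × b ≡ suc j) ⊎ Peak (suc i) (k + j) (K′ ρ) a b →
  Peak i j (u ∷ replicate k d ++ K′ ρ) a b
Peak-block⁺ (suc k) ρ (inj₁ (_ , refl , refl)) = here
Peak-block⁺ k       ρ (inj₂ p)                 = after-u (Peak-dᵏ⁺ k p)

data RMax : List ℕ → ℕ → ℕ → Set where
  here  : All (_< x) ρ → RMax (x ∷ ρ) 1 x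
  there : RMax ρ p y → RMax (x ∷ ρ) (suc p) y

All-lookup⁺ : ∀ {P : ℕ → Set} ρ → (∀ q → P (lookup ρ q)) → All P ρ
All-lookup⁺ {P} ρ f = subst (All P) (tabulate-lookup ρ) (tabulate⁺ f)

All-lookup⁻ : ∀ {P : ℕ → Set} ρ → All P ρ → ∀ q → P (lookup ρ q)
All-lookup⁻ {P} ρ h = tabulate⁻ (subst (All P) (sym (tabulate-lookup ρ)) h)

InRMAX⇒RMax : ∀ ρ → InRMAX ρ p x → RMax ρ p x
InRMAX⇒RMax (x ∷ ρ) (zero  , refl , refl , later<x) = here (All-lookup⁺ ρ (λ q → later<x (suc q) z<s))
InRMAX⇒RMax (x ∷ ρ) (suc p , refl , refl , later<x) =
  there (InRMAX⇒RMax ρ (p , refl , refl , λ q p<q → later<x (suc q) (s≤s p<q)))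

RMax⇒InRMAX : RMax ρ p x → InRMAX ρ p x
RMax⇒InRMAX {x ∷ ρ} (here ρ<x) = zero , refl , refl , later<x
  where
  later<x : ∀ q → 0 < toℕ q → lookup (x ∷ ρ) q < x
  later<x (suc q) _ = All-lookup⁻ ρ ρ<x q
RMax⇒InRMAX {z ∷ ρ} {x = y} (there r) with RMax⇒InRMAX r
... | p , refl , refl , later< = suc p , refl , refl , later<′
  where
  later<′ : ∀ q → suc (toℕ p) < toℕ q → lookup (z ∷ ρ) q < y
  later<′ (suc q) (s≤s p<q) = later< q p<q

peak⇒rmax : ∀ ρ → Peak i j (K′ ρ) a b →
  ∃₂ λ p y → RMax ρ p y × i + p ≡ a × b + y ≡ suc (j + maximum ρ)
peak⇒rmax {i} {j} (x ∷ ρ) q with Peak-block⁻ (x ∸ maximum ρ) ρ q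
... | inj₁ (0<k , refl , refl) =
  1 , x , here (maximum<⇒All< m<x) , +-comm i 1 , cong (λ t → suc (j + t)) (sym (m≥n⇒m⊔n≡m (<⇒≤ m<x)))
  where
  m<x : maximum ρ < x
  m<x = m∸n>0⇒n<m 0<k
... | inj₂ q′ with peak⇒rmax ρ q′
...   | p , y , r , refl , e =
  suc p , y , there r , +-suc i p , trans e (cong suc (m∸n+o+n≡o+[m⊔n] x (maximum ρ) j))

rmax⇒peak : ∀ ρ → All (0 <_) ρ → RMax ρ p y → b + y ≡ suc (j + maximum ρ) →
  Peak i j (K′ ρ) (i + p) b
rmax⇒peak {b = b} {j} {i} (x ∷ ρ) (0<x ∷ _) (here ρ<x) e =
  subst (λ a → Peak i j (K′ (x ∷ ρ)) a b) (+-comm 1 i)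
    (Peak-block⁺ (x ∸ maximum ρ) ρ (inj₁ (m<n⇒0<n∸m m<x , refl , b≡1+j)))
  where
  m<x : maximum ρ < x
  m<x = All<⇒maximum< 0<x ρ<x
  b≡1+j : b ≡ suc j
  b≡1+j = +-cancelʳ-≡ x b (suc j) (trans e (cong (λ t → suc (j + t)) (m≥n⇒m⊔n≡m (<⇒≤ m<x))))
rmax⇒peak {b = b} {j} {i} (x ∷ ρ) (_ ∷ ρ>0) (there {p = p} r) e =
  subst (λ a → Peak i j (K′ (x ∷ ρ)) a b) (sym (+-suc i p))
    (Peak-block⁺ (x ∸ maximum ρ) ρ
      (inj₂ (rmax⇒peak ρ ρ>0 r (trans e (cong suc (sym (m∸n+o+n≡o+[m⊔n] x (maximum ρ) j)))))))

IsPerm⇒length≡ : IsPerm n ρ → length ρ ≡ n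
IsPerm⇒length≡ {n} perm = trans (↭-length perm) (trans (length-map suc (upTo n)) (length-upTo n))

IsPerm⇒entries : IsPerm n ρ → All (λ y → 0 < y × y ≤ n) ρ
IsPerm⇒entries perm = All-resp-↭ (↭-sym perm) (All.tabulate entry)
  where
  entry : y ∈ map suc (upTo n) → 0 < y × y ≤ n
  entry y∈ with ∈-map⁻ suc y∈
  ... | _ , x∈ , refl = z<s , ∈-upTo⁻ x∈

IsPerm⇒maximum≡ : IsPerm n ρ → maximum ρ ≡ n
IsPerm⇒maximum≡ {n} {ρ} perm = ≤-antisym (maximum≤ (All.map proj₂ (IsPerm⇒entries perm))) (n≤maximum n perm)
  where
  n≤maximum : ∀ n → IsPerm n ρ → n ≤ maximum ρ
  n≤maximum zero    _    = z≤n
  n≤maximum (suc n) perm = All.lookup (xs≤maximum ρ) (∈-resp-↭ (↭-sym perm) (∈-map⁺ suc (∈-upTo⁺ ≤-refl)))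

peak-in-range : #u P ≡ n → #d P ≡ n → Peak 0 0 P a b → 1 ≤ b × b ≤ n × 1 ≤ a × a ≤ n
peak-in-range #u≡n #d≡n p with peak-up-bounds p | peak-down-bounds p
... | 0<a , a≤ | 0<b , b≤ = 0<b , subst (_ ≤_) #d≡n b≤ , 0<a , subst (_ ≤_) #u≡n a≤

InRMAX⇔Peak-K′ : IsPerm n ρ → b ≤ n → InRMAX ρ a (suc n ∸ b) ⇔ Peak 0 0 (K′ ρ) a b
InRMAX⇔Peak-K′ {n} {ρ} {b} {a} perm b≤n = mk⇔
  (λ r → rmax⇒peak ρ (All.map proj₁ (IsPerm⇒entries perm)) (InRMAX⇒RMax ρ r)
           (trans (m+[n∸m]≡n (m≤n⇒m≤1+n b≤n)) (cong suc (sym (IsPerm⇒maximum≡ perm)))))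
  (λ p → from (peak⇒rmax ρ p))
  where
  from : (∃₂ λ p y → RMax ρ p y × p ≡ a × b + y ≡ suc (maximum ρ)) → InRMAX ρ a (suc n ∸ b)
  from (p , y , r , refl , e) = RMax⇒InRMAX (subst (RMax ρ p) y≡1+n∸b r)
    where
    y≡1+n∸b : y ≡ suc n ∸ b
    y≡1+n∸b = trans (sym (m+n∸m≡n b y)) (cong (_∸ b) (trans e (cong suc (IsPerm⇒maximum≡ perm))))

lemma5 : (n : ℕ) → 1 ≤ n → (π : List ℕ) → IsPerm123 n π → (P : List Step) → IsDyck n P →
    (K π ≡ P) ⇔ ((i a : ℕ) → 1 ≤ i → i ≤ n → 1 ≤ a → a ≤ n →
      (InRMAX π a (suc n ∸ i) ⇔ InPEAK P a i))
lemma5 n _ π (perm , _) P (#uP≡n , #dP≡n , _) = mk⇔ peaks-match K≡P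
  where
  open Equivalence using (to; from)

  PeaksMatch : Set
  PeaksMatch = ∀ i a → 1 ≤ i → i ≤ n → 1 ≤ a → a ≤ n → InRMAX π a (suc n ∸ i) ⇔ InPEAK P a i

  peaks-match : K π ≡ P → PeaksMatch
  peaks-match K≡P i a _ i≤n _ _ = subst (λ Q → InRMAX π a (suc n ∸ i) ⇔ InPEAK Q a i)
    (trans (sym (K≡K′ π)) K≡P) (⇔.trans (InRMAX⇔Peak-K′ perm i≤n) (⇔.sym InPEAK⇔Peak))

  #uK′≡n : #u (K′ π) ≡ n
  #uK′≡n = trans (#u-K′ π) (IsPerm⇒length≡ perm)
  #dK′≡n : #d (K′ π) ≡ n
  #dK′≡n = trans (#d-K′ π) (IsPerm⇒maximum≡ perm)

  K≡P : PeaksMatch → K π ≡ P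
  K≡P H = trans (K≡K′ π)
    (peaks-determine (K′ π) P (trans #uK′≡n (sym #uP≡n)) (trans #dK′≡n (sym #dP≡n)) K′⊆P P⊆K′)
    where
    K′⊆P : Peak 0 0 (K′ π) ⇒ Peak 0 0 P
    K′⊆P p with peak-in-range #uK′≡n #dK′≡n p
    ... | 1≤b , b≤n , 1≤a , a≤n =
      to InPEAK⇔Peak (to (H _ _ 1≤b b≤n 1≤a a≤n) (from (InRMAX⇔Peak-K′ perm b≤n) p))
    P⊆K′ : Peak 0 0 P ⇒ Peak 0 0 (K′ π)
    P⊆K′ p with peak-in-range #uP≡n #dP≡n p
    ... | 1≤b , b≤n , 1≤a , a≤n =
      to (InRMAX⇔Peak-K′ perm b≤n) (from (H _ _ 1≤b b≤n 1≤a a≤n) (from InPEAK⇔Peak p))
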